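{- Let $n$ be a positive integer and $\lambda$ a partition of $n$. The game tree of $\mathcal{D}(\lambda)$ has at least $1$ leaf, and the game tree of $\mathcal{L}(\lambda)$ has at least $n+1$ leaves. Both lower bounds are tight, i.e. for each $n$ there is a partition of $n$ attaining each bound (namely $\lambda=(n)$).
   Context: For a partition $\mu=(\mu_1,\dots,\mu_s)$ and nonnegative integers $i,j$, $\mu[i,j]$ is $(\mu_{i+1}-j,\mu_{i+2}-j,\dots)$ with nonpositive entries removed, if $i<s$ and $j<\mu_{i+1}$; otherwise $\mu[i,j]=()$. LCTR $\mathcal{L}(\lambda)$: from a nonempty $\mu$ one moves to $\mu[1,0]$ or $\mu[0,1]$ (two distinct moves); $()$ is terminal. Downright $\mathcal{D}(\lambda)$ (nonempty $\lambda$): from $\mu=(\mu_1,\dots,\mu_s)$ one may move to $\mu[1,0]$ if $s>1$ and to $\mu[0,1]$ if $\mu_1>1$. The game tree $T_p$ at position $p$ is the rooted tree with root $p$ and, for each move $p\to\tilde p$, an edge from $p$ to the root of a copy of $T_{\tilde p}$; leaves are counted with multiplicity. -}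

module Defs where

open import Data.Nat using (ℕ; zero; suc; _+_; _∸_; _<_; _≤_; _≥_; _<ᵇ_)
open import Data.Bool using (Bool; true; false; if_then_else_; _∧_)
open import Data.List using (List; []; _∷_; length; drop; map; filter)
open import Data.Nat.ListAction using (sum)
open import Data.List.Relation.Unary.All using (All)
open import Data.List.Relation.Unary.Linked using (Linked)
import Data.Nat.Properties
open import Relation.Binary.PropositionalEquality using (_≡_)

record IsPartition (n : ℕ) (μ : List ℕ) : Set where
  field
    positive   : All (λ x → 0 < x) μ
    decreasing : Linked _≥_ μ
    sums       : sum μ ≡ n

-- i-th entry (0-indexed), i.e. μ_{i+1}; 0 if out of range
entry : List ℕ → ℕ → ℕ
entry []       _       = 0
entry (x ∷ _)  zero    = x
entry (_ ∷ xs) (suc i) = entry xs i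

_[_,_] : List ℕ → ℕ → ℕ → List ℕ
μ [ i , j ] =
  if (i <ᵇ length μ) ∧ (j <ᵇ entry μ i)
  then filter (λ x → 0 <? x) (map (λ x → x ∸ j) (drop i μ))
  else []
  where
    _<?_ = Data.Nat.Properties._<?_

-- Number of leaves (with multiplicity) of the LCTR game tree, computed with
-- fuel.  Each move from a nonempty position strictly decreases
-- (sum μ + length μ), so fuel  sum μ + length μ + 1  is always sufficient.
leavesLfuel : ℕ → List ℕ → ℕ
leavesLfuel _        []          = 1
leavesLfuel zero     (_ ∷ _)     = 1
leavesLfuel (suc k)  μ@(_ ∷ _)   =
  leavesLfuel k (μ [ 1 , 0 ]) + leavesLfuel k (μ [ 0 , 1 ])

leavesL : List ℕ → ℕ
leavesL μ = leavesLfuel (suc (sum μ + length μ)) μ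

-- Downright: from (μ_1,...,μ_s), move to μ[1,0] if s > 1, to μ[0,1] if μ_1 > 1.
-- A position is a leaf iff it has no moves.
leavesDfuel : ℕ → List ℕ → ℕ
leavesDfuel zero    _ = 1
leavesDfuel (suc k) μ with 1 <ᵇ length μ | 1 <ᵇ entry μ 0
... | false | false = 1
... | true  | false = leavesDfuel k (μ [ 1 , 0 ])
... | false | true  = leavesDfuel k (μ [ 0 , 1 ])
... | true  | true  = leavesDfuel k (μ [ 1 , 0 ]) + leavesDfuel k (μ [ 0 , 1 ])

leavesD : List ℕ → ℕ
leavesD μ = leavesDfuel (suc (sum μ + length μ)) μ

-- For LCTR, λ[0,1] deletes the first column, and
-- iterating that move from a position with first row x reaches () after x
-- steps, collecting one leaf from the row-deleting branch at each step; so
-- the subtree at λ[0,1] has at least λ₁ leaves.  Since λ[1,0] deletes the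
-- first row, induction on the rows gives at least (λ₁ + λ₂ + ⋯) + 1 = n + 1
-- leaves.  For λ = (n) both trees are paths, with 1 and n + 1 leaves.
module Submission where

open import Defs
open import Data.Nat using (ℕ; zero; suc; _+_; _≤_; _<_; _<ᵇ_; z≤n; s≤s)
open import Data.Nat.Properties using (_<?_; +-comm; +-identityʳ; +-mono-≤; m≤m+n; n≤1+n; ≤-trans; ≤-reflexive)
open import Data.Nat.ListAction using (sum)
open import Data.List using (List; []; _∷_; length; filter)
open import Data.List.Properties using (map-id; filter-all)
open import Data.List.Relation.Unary.All using (All; []; _∷_)
open import Data.List.Relation.Unary.Linked using ([-])
open import Data.Bool using (true; false)
open import Data.Product using (_×_; _,_)
open import Relation.Binary.PropositionalEquality using (_≡_; refl; cong; trans; subst)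

leavesDfuel-positive : ∀ k μ → 1 ≤ leavesDfuel k μ
leavesDfuel-positive zero    μ = s≤s z≤n
leavesDfuel-positive (suc k) μ with 1 <ᵇ length μ | 1 <ᵇ entry μ 0
... | false | false = s≤s z≤n
... | true  | false = leavesDfuel-positive k _
... | false | true  = leavesDfuel-positive k _
... | true  | true  = ≤-trans (leavesDfuel-positive k _) (m≤m+n _ _)

leavesLfuel-positive : ∀ k μ → 1 ≤ leavesLfuel k μ
leavesLfuel-positive _       []       = s≤s z≤n
leavesLfuel-positive zero    (_ ∷ _)  = s≤s z≤n
leavesLfuel-positive (suc k) (x ∷ xs) = ≤-trans (leavesLfuel-positive k ((x ∷ xs) [ 1 , 0 ])) (m≤m+n _ _)

leavesLfuel-≥-firstRow : ∀ k x xs → x ≤ k → suc x ≤ leavesLfuel k (x ∷ xs)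
leavesLfuel-≥-firstRow k       zero          xs _       = leavesLfuel-positive k (0 ∷ xs)
leavesLfuel-≥-firstRow (suc k) (suc zero)    xs _       =
  +-mono-≤ (leavesLfuel-positive k ((1 ∷ xs) [ 1 , 0 ])) (leavesLfuel-positive k ((1 ∷ xs) [ 0 , 1 ]))
leavesLfuel-≥-firstRow (suc k) (suc (suc x)) xs (s≤s x≤k) =
  +-mono-≤ (leavesLfuel-positive k ((suc (suc x) ∷ xs) [ 1 , 0 ])) (leavesLfuel-≥-firstRow k (suc x) _ x≤k)

leavesLfuel-≥-firstRow-[0,1] : ∀ k x xs → x ≤ suc k → x ≤ leavesLfuel k ((x ∷ xs) [ 0 , 1 ])
leavesLfuel-≥-firstRow-[0,1] k zero          xs _         = z≤n
leavesLfuel-≥-firstRow-[0,1] k (suc zero)    xs _         = leavesLfuel-positive k ((1 ∷ xs) [ 0 , 1 ])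
leavesLfuel-≥-firstRow-[0,1] k (suc (suc x)) xs (s≤s x≤k) = leavesLfuel-≥-firstRow k (suc x) _ x≤k

[1,0]-positive : ∀ x xs → All (0 <_) xs → (x ∷ xs) [ 1 , 0 ] ≡ xs
[1,0]-positive x []            []           = refl
[1,0]-positive x (suc y ∷ ys) (_ ∷ ys>0) = cong (suc y ∷_) (trans (cong (filter (0 <?_)) (map-id ys)) (filter-all (0 <?_) ys>0))

leavesLfuel-≥-size : ∀ k μ → All (0 <_) μ → sum μ ≤ k → suc (sum μ) ≤ leavesLfuel k μ
leavesLfuel-≥-size k       []             _             _ = s≤s z≤n
leavesLfuel-≥-size k       (zero ∷ xs)    (() ∷ _)      _
leavesLfuel-≥-size zero    (suc x ∷ xs)   _             ()
leavesLfuel-≥-size (suc k) (suc x ∷ xs)   (_ ∷ xs>0) (s≤s size≤k) =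
  ≤-trans (≤-reflexive (cong suc (+-comm (suc x) (sum xs))))
    (+-mono-≤ tail-bound
              (leavesLfuel-≥-firstRow-[0,1] k (suc x) xs (s≤s (≤-trans (m≤m+n x (sum xs)) size≤k))))
  where
    tail-bound : suc (sum xs) ≤ leavesLfuel k ((suc x ∷ xs) [ 1 , 0 ])
    tail-bound rewrite [1,0]-positive (suc x) xs xs>0 =
      leavesLfuel-≥-size k xs xs>0 (≤-trans (m≤m+n (sum xs) x) (≤-trans (≤-reflexive (+-comm (sum xs) x)) size≤k))

size≤fuel : ∀ μ → sum μ ≤ suc (sum μ + length μ)
size≤fuel μ = ≤-trans (m≤m+n (sum μ) (length μ)) (n≤1+n _)

leavesDfuel-singleton : ∀ k n → leavesDfuel k (n ∷ []) ≡ 1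
leavesDfuel-singleton zero    n             = refl
leavesDfuel-singleton (suc k) zero          = refl
leavesDfuel-singleton (suc k) (suc zero)    = refl
leavesDfuel-singleton (suc k) (suc (suc n)) = leavesDfuel-singleton k (suc n)

leavesLfuel-singleton : ∀ k n → suc n ≤ k → leavesLfuel k (suc n ∷ []) ≡ suc (suc n)
leavesLfuel-singleton (suc k) zero    _          = refl
leavesLfuel-singleton (suc k) (suc n) (s≤s n<k) = cong suc (leavesLfuel-singleton k n n<k)

singleton-isPartition : ∀ n → 1 ≤ n → IsPartition n (n ∷ [])
singleton-isPartition (suc n) _ =
  record { positive = s≤s z≤n ∷ [] ; decreasing = [-] ; sums = +-identityʳ (suc n) }

lemma6p7 : (n : ℕ) → 1 ≤ n →
    ((λ' : List ℕ) → IsPartition n λ' → (1 ≤ leavesD λ') × (n + 1 ≤ leavesL λ'))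
    × (IsPartition n (n ∷ []) × leavesD (n ∷ []) ≡ 1 × leavesL (n ∷ []) ≡ n + 1)
lemma6p7 n@(suc m) 1≤n =
  lowerBounds , singleton-isPartition n 1≤n , leavesDfuel-singleton _ n , leavesL-singleton
  where
    lowerBounds : (λ' : List ℕ) → IsPartition n λ' → (1 ≤ leavesD λ') × (n + 1 ≤ leavesL λ')
    lowerBounds λ' p = leavesDfuel-positive _ λ' , subst (λ s → s + 1 ≤ leavesL λ') sums
      (≤-trans (≤-reflexive (+-comm (sum λ') 1)) (leavesLfuel-≥-size _ λ' positive (size≤fuel λ')))
      where open IsPartition p

    leavesL-singleton : leavesL (n ∷ []) ≡ n + 1
    leavesL-singleton = trans
      (leavesLfuel-singleton (suc (n + 0 + 1)) m (subst (_≤ suc (n + 0 + 1)) (+-identityʳ n) (size≤fuel (n ∷ []))))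
      (+-comm 1 n)
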